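{- Let $(G,k)$ be an instance of CTVD and let $P = (v_1, v_2, \dots, v_\ell)$ with $\ell \ge 5$ be a path in $G$ such that $d_G(v_i) = 2$ for every $2 \le i \le \ell - 1$ and $d_G(v_1) > 2$, $d_G(v_\ell) > 2$. Let $Z = \{v_3, \dots, v_{\ell-2}\}$ and let $G'$ be the graph obtained from $G$ by deleting the vertices of $Z$ and adding the edge $v_2 v_{\ell-1}$. Then $(G,k)$ is a yes-instance if and only if $(G',k)$ is a yes-instance.
   Context: CTVD: given a multigraph $G$ (loops and parallel edges allowed) and an integer $k$, decide whether there is $S\subseteq V(G)$ with $|S|\le k$ such that $G-S$ is simple and every connected component of $G-S$ is a clique or a tree. $d_G(v)$ is the number of edges of $G$ incident to $v$, counted with multiplicity. Such a path $P$ is called a degree-2-overbridge of length $\ell$. -}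

module Defs where

open import Data.Nat using (ℕ; zero; suc; _≤_; _<_; _∸_)
open import Data.Fin using (Fin; zero; suc; toℕ; inject₁; fromℕ; _≟_)
open import Data.Fin.Subset using (Subset; _∈_; _∉_; ∣_∣)
open import Data.List using (List; []; _∷_; _++_; length; filter)
open import Data.List.Relation.Unary.Any using (Any)
open import Data.Product using (Σ; ∃; _×_; _,_; proj₁; proj₂)
open import Data.Sum using (_⊎_)
open import Data.Unit using (⊤)
open import Data.Empty using (⊥)
open import Relation.Nullary using (¬_)
open import Relation.Nullary.Decidable using (_⊎-dec_)
open import Relation.Binary.PropositionalEquality using (_≡_; _≢_)
open import Relation.Binary.Construct.Closure.ReflexiveTransitive using (Star)
open import Function.Definitions using (Injective)

-- A multigraph on (a subset of) the vertex universe Fin n is given by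
--   * a vertex predicate V : Fin n → Set (which vertices are present), and
--   * a list E of edges (pairs of vertices); loops are pairs (x , x) and
--     parallel edges are repeated entries of the list.
-- An edge of the list is "live" (belongs to the graph) iff both its
-- endpoints are present.  Deleting a vertex set S shrinks V; edges touching
-- S then automatically stop being live (this is G - S).

Edge : ℕ → Set
Edge n = Fin n × Fin n

Live : ∀ {n} → (Fin n → Set) → Edge n → Set
Live V e = V (proj₁ e) × V (proj₂ e)

Joins : ∀ {n} → Edge n → Fin n → Fin n → Set
Joins e x y = (proj₁ e ≡ x × proj₂ e ≡ y) ⊎ (proj₁ e ≡ y × proj₂ e ≡ x)

lookupE : ∀ {n} (E : List (Edge n)) → Fin (length E) → Edge n
lookupE (e ∷ E) zero = e
lookupE (e ∷ E) (suc i) = lookupE E i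

Simple : ∀ {n} → (Fin n → Set) → List (Edge n) → Set
Simple V E =
  (∀ (i : Fin (length E)) → Live V (lookupE E i) →
     proj₁ (lookupE E i) ≢ proj₂ (lookupE E i))
  × (∀ (i j : Fin (length E)) x y →
       Live V (lookupE E i) → Live V (lookupE E j) →
       Joins (lookupE E i) x y → Joins (lookupE E j) x y → i ≡ j)

Adj : ∀ {n} → (Fin n → Set) → List (Edge n) → Fin n → Fin n → Set
Adj V E x y = Any (λ e → Live V e × Joins e x y) E

Reach : ∀ {n} → (Fin n → Set) → List (Edge n) → Fin n → Fin n → Set
Reach V E = Star (Adj V E)

-- the connected component of a present vertex u is {x | Reach V E u x}

CompClique : ∀ {n} → (Fin n → Set) → List (Edge n) → Fin n → Set
CompClique V E u = ∀ x y → Reach V E u x → Reach V E u y → x ≢ y → Adj V E x y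

-- a cycle of length m+3: distinct vertices w 0, …, w (m+2), consecutive
-- ones adjacent and w (m+2) adjacent to w 0
record Cycle {n} (V : Fin n → Set) (E : List (Edge n)) : Set where
  field
    m   : ℕ
    w   : Fin (suc (suc (suc m))) → Fin n
    inj : Injective _≡_ _≡_ w
    step : ∀ (i : Fin (suc (suc m))) → Adj V E (w (inject₁ i)) (w (suc i))
    close : Adj V E (w (fromℕ (suc (suc m)))) (w zero)

-- the component of u is a tree: it is connected by definition, and it is
-- acyclic (no cycle all of whose vertices lie in the component)
CompTree : ∀ {n} → (Fin n → Set) → List (Edge n) → Fin n → Set
CompTree V E u = ¬ (Σ (Cycle V E) λ c → ∀ i → Reach V E u (Cycle.w c i))

Del : ∀ {n} → (Fin n → Set) → Subset n → Fin n → Set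
Del V S x = V x × x ∉ S

GoodDeletion : ∀ {n} → (Fin n → Set) → List (Edge n) → Subset n → Set
GoodDeletion V E S =
  Simple (Del V S) E
  × (∀ u → Del V S u → CompClique (Del V S) E u ⊎ CompTree (Del V S) E u)

YesCTVD : ∀ {n} → (Fin n → Set) → List (Edge n) → ℕ → Set
YesCTVD {n} V E k =
  Σ (Subset n) λ S → (∀ x → x ∈ S → V x) × ∣ S ∣ ≤ k × GoodDeletion V E S

-- degree in a multigraph whose vertex set is all of Fin n: number of edges
-- incident to v counted with multiplicity (a loop at v is one incident edge)
deg : ∀ {n} → List (Edge n) → Fin n → ℕ
deg E v = length (filter (λ e → (proj₁ e ≟ v) ⊎-dec (proj₂ e ≟ v)) E)

AllV : ∀ {n} → Fin n → Set
AllV _ = ⊤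

-- Z = { v_3 , … , v_(ℓ-2) }  (1-indexed), i.e. indices 2 … ℓ-3 (0-indexed)
InZ : ∀ {n ℓ} → (Fin ℓ → Fin n) → Fin n → Set
InZ {ℓ = ℓ} v x = Σ (Fin _) λ i → 2 ≤ toℕ i × toℕ i ≤ ℓ ∸ 3 × v i ≡ x

-- Write Z = {v₃, …, v_(ℓ-2)} and let Gⱼ (2 ≤ j ≤ ℓ - 2) be G with v₃, …, vⱼ deleted and the
-- edge v₂vⱼ₊₁ added, so that G₂ is G with v₂v₃ doubled and G_(ℓ-2) = G′. If S avoids Z, then
-- Gⱼ₊₁ − S arises from Gⱼ − S by suppressing the degree-2 vertex vⱼ₊₁, or, when one or both of
-- its neighbours v₂, vⱼ₊₂ lie in S, by deleting a pendant or isolated vertex. Since v₂ and vⱼ₊₂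
-- are not adjacent in Gⱼ and have no common neighbour in Gⱼ₊₁, none of these operations changes
-- whether every component is a clique or a tree; and as the vertices of Z have degree 2, G − S
-- is simple iff G′ − S is. A solution S of G′ avoids Z. A solution S of G meeting Z is replaced
-- by (S ∖ Z) ∪ {v₂}, which is no larger, and G′ minus it is an induced subgraph of G − S.

module Submission where

open import Defs
open import Level using (0ℓ)
open import Data.Bool using (if_then_else_)
open import Data.Empty using (⊥; ⊥-elim)
open import Data.Fin using (Fin; zero; suc; toℕ; inject₁; fromℕ; fromℕ<; _≟_)
open import Data.Fin.Properties using (suc-injective; toℕ<n; toℕ-fromℕ<; fromℕ<-toℕ; any?)
open import Data.Fin.Subset using (Subset; Side; inside; outside; ∣_∣) renaming (_∈_ to _∈ₛ_; _∉_ to _∉ₛ_)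
open import Data.Fin.Subset.Properties using (p⊂q⇒∣p∣<∣q∣) renaming (_∈?_ to _∈ₛ?_)
open import Data.List using (List; []; _∷_; _++_; _∷ʳ_; [_]; length; filter; tabulate; lookup)
open import Data.List.Properties using (++-assoc; ++-identityʳ; length-++; filter-accept; filter-reject; length-tabulate)
open import Data.List.Membership.Propositional using (_∈_; _∉_)
open import Data.List.Membership.Propositional.Properties using (∈-∃++; ∈-++⁺ˡ; ∈-++⁺ʳ; ∈-++⁻; ∈-lookup)
import Data.List.Membership.DecPropositional as DecMembership
open import Data.List.Relation.Binary.Subset.Propositional using (_⊆_)
open import Data.List.Relation.Unary.All as All using (All; []; _∷_)
import Data.List.Relation.Unary.All.Properties as All
open import Data.List.Relation.Unary.AllPairs using ([]; _∷_)
open import Data.List.Relation.Unary.Any as Any using (Any; here; there)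
import Data.List.Relation.Unary.Any.Properties as Any
open import Data.List.Relation.Unary.Unique.Propositional using (Unique)
import Data.List.Relation.Unary.Unique.Propositional.Properties as Unique
open import Data.Nat using (ℕ; zero; suc; _+_; _≤_; _<_; _∸_; z≤n; s≤s; _≤?_; _<?_)
open import Data.Nat.Properties
  using (+-comm; ≤-trans; ≤-refl; ≤-antisym; ≤-pred; n≤1+n; m≤n⇒m≤1+n; <-irrefl; <⇒≤; ≰⇒>)
open import Data.Product as Product using (Σ; ∃; ∃₂; _×_; _,_; proj₁; proj₂)
open import Data.Sum as Sum using (_⊎_; inj₁; inj₂)
open import Data.Unit using (⊤; tt)
open import Data.Vec as Vec using (_∷_)
open import Data.Vec.Properties using ([]=⇒lookup; lookup⇒[]=; lookup∘tabulate; lookup∘update; lookup∘update′)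
open import Function using (_∘_; id)
open import Function.Bundles using (_⇔_; mk⇔; Equivalence)
open import Function.Construct.Composition using (_⇔-∘_)
open import Function.Construct.Identity using (⇔-id)
open import Function.Definitions using (Injective)
open import Relation.Binary using (Rel; _⇒_; Symmetric; Decidable; DecidableEquality)
open import Relation.Binary.Construct.Closure.ReflexiveTransitive as Star
  using (Star; ε; _◅_; _◅◅_; kleisliStar; reverse; _⋆)
open import Relation.Binary.PropositionalEquality
  using (_≡_; _≢_; refl; sym; trans; cong; cong₂; subst; subst₂; ≢-sym; module ≡-Reasoning)
open import Relation.Nullary using (¬_; Dec; yes; no; does)
import Relation.Nullary.Decidable as Dec
open import Relation.Nullary.Decidable using (_×-dec_; _⊎-dec_)
open import Relation.Unary as U using (Pred)

module _ {V : Set} where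

  Star-unsnoc : ∀ {A : Rel V 0ℓ} {u t} → Star A u t → u ≡ t ⊎ ∃ λ z → Star A u z × A z t
  Star-unsnoc ε = inj₁ refl
  Star-unsnoc (e ◅ s) with Star-unsnoc s
  ... | inj₁ refl            = inj₂ (_ , ε , e)
  ... | inj₂ (z , s′ , e′)   = inj₂ (z , e ◅ s′ , e′)

  Star-closed : ∀ {A : Rel V 0ℓ} {P : Pred V 0ℓ} → (∀ {a b} → A a b → P b) →
                ∀ {u z} → P u → Star A u z → P z
  Star-closed A⇒P pu ε       = pu
  Star-closed A⇒P pu (e ◅ s) = Star-closed A⇒P (A⇒P e) s

  ∉⇒All≢ : ∀ {x : V} {xs} → x ∉ xs → All (_≢ x) xs
  ∉⇒All≢ x∉ = All.map (_∘ sym) (All.¬Any⇒All¬ _ x∉)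

  unique-∷ʳ⁺ : ∀ {l} {t : V} → Unique l → All (_≢ t) l → Unique (l ∷ʳ t)
  unique-∷ʳ⁺ []      []           = [] ∷ []
  unique-∷ʳ⁺ (a ∷ u) (x≢t ∷ l≢t) = All.∷ʳ⁺ a x≢t ∷ unique-∷ʳ⁺ u l≢t

  rotate-⊆ : ∀ pre (x : V) post → (x ∷ post ++ pre) ⊆ (pre ++ x ∷ post)
  rotate-⊆ pre x post (here e) = ∈-++⁺ʳ pre (here e)
  rotate-⊆ pre x post (there m) with ∈-++⁻ post m
  ... | inj₁ m′ = ∈-++⁺ʳ pre (there m′)
  ... | inj₂ m′ = ∈-++⁺ˡ m′

  Walk : Rel V 0ℓ → V → List V → Set
  Walk A a []      = ⊤
  Walk A a (b ∷ l) = A a b × Walk A b l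

  walkEnd : V → List V → V
  walkEnd a []      = a
  walkEnd a (b ∷ l) = walkEnd b l

  walkEnd-∷ʳ : ∀ a l t → walkEnd a (l ∷ʳ t) ≡ t
  walkEnd-∷ʳ a []      t = refl
  walkEnd-∷ʳ a (b ∷ l) t = walkEnd-∷ʳ b l t

  walkEnd-∈ : ∀ a l → walkEnd a l ∈ a ∷ l
  walkEnd-∈ a []      = here refl
  walkEnd-∈ a (b ∷ l) = there (walkEnd-∈ b l)

  module _ {A : Rel V 0ℓ} where

    walk-∷ʳ⁺ : ∀ a l {t} → Walk A a l → A (walkEnd a l) t → Walk A a (l ∷ʳ t)
    walk-∷ʳ⁺ a []      _        e = e , tt
    walk-∷ʳ⁺ a (b ∷ l) (e₀ , p) e = e₀ , walk-∷ʳ⁺ b l p e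

    walk-∷ʳ⁻ : ∀ a l {t} → Walk A a (l ∷ʳ t) → Walk A a l × A (walkEnd a l) t
    walk-∷ʳ⁻ a []      (e , _)  = tt , e
    walk-∷ʳ⁻ a (b ∷ l) (e₀ , p) = Product.map₁ (e₀ ,_) (walk-∷ʳ⁻ b l p)

  walk-map : ∀ {A B : Rel V 0ℓ} {P : Pred V 0ℓ} → (∀ {a b} → P a → P b → A a b → B a b) →
             ∀ {a} l → P a → All P l → Walk A a l → Walk B a l
  walk-map f []      pa []        _       = tt
  walk-map f (b ∷ l) pa (pb ∷ pl) (e , p) = f pa pb e , walk-map f l pb pl p

  ≢-walkEnd : ∀ {a : V} b l → All (a ≢_) (b ∷ l) → a ≢ walkEnd b l
  ≢-walkEnd b l a≢ = All.lookup a≢ (walkEnd-∈ b l)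

  ClosedWalk : Rel V 0ℓ → List V → Set
  ClosedWalk A []      = ⊥
  ClosedWalk A (a ∷ l) = Walk A a (l ∷ʳ a)

  IsCycle : Rel V 0ℓ → List V → Set
  IsCycle A vs = 3 ≤ length vs × Unique vs × ClosedWalk A vs

  isCycle-map : ∀ {A B : Rel V 0ℓ} {P : Pred V 0ℓ} → (∀ {a b} → P a → P b → A a b → B a b) →
                ∀ {vs} → All P vs → IsCycle A vs → IsCycle B vs
  isCycle-map f {a ∷ l} (pa ∷ pl) (len , u , p) = len , u , walk-map f (l ∷ʳ a) pa (All.∷ʳ⁺ pl pa) p

  isCycle-map⇒ : ∀ {A B : Rel V 0ℓ} → A ⇒ B → ∀ {vs} → IsCycle A vs → IsCycle B vs
  isCycle-map⇒ A⇒B {vs} = isCycle-map {P = λ _ → ⊤} (λ _ _ → A⇒B) (All.universal (λ _ → tt) vs)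

  isCycle-rotate₁ : ∀ {A : Rel V 0ℓ} a l → IsCycle A (a ∷ l) → IsCycle A (l ∷ʳ a)
  isCycle-rotate₁ a []      (s≤s () , _)
  isCycle-rotate₁ {A} a (b ∷ l) (len , (a∉ ∷ u) , e , p) =
    subst (3 ≤_) (trans (+-comm 1 (length (b ∷ l))) (sym (length-++ (b ∷ l)))) len ,
    unique-∷ʳ⁺ u (All.map ≢-sym a∉) ,
    walk-∷ʳ⁺ b (l ∷ʳ a) p (subst (λ z → A z b) (sym (walkEnd-∷ʳ b l a)) e)

  isCycle-rotate : ∀ {A : Rel V 0ℓ} pre x post → IsCycle A (pre ++ x ∷ post) → IsCycle A (x ∷ post ++ pre)
  isCycle-rotate {A} [] x post c = subst (λ l → IsCycle A (x ∷ l)) (sym (++-identityʳ post)) c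
  isCycle-rotate {A} (p ∷ pre) x post c =
    subst (λ l → IsCycle A (x ∷ l)) (++-assoc post [ p ] pre)
      (isCycle-rotate pre x (post ∷ʳ p)
        (subst (IsCycle A) (++-assoc pre (x ∷ post) [ p ]) (isCycle-rotate₁ p (pre ++ x ∷ post) c)))

  isCycle-rotateTo : ∀ {A : Rel V 0ℓ} {x vs} → x ∈ vs → IsCycle A vs →
                     ∃ λ r → IsCycle A (x ∷ r) × (x ∷ r) ⊆ vs
  isCycle-rotateTo {x = x} x∈ c with ∈-∃++ x∈
  ... | pre , post , refl = post ++ pre , isCycle-rotate pre x post c , rotate-⊆ pre x post

  isCycle-three : ∀ {A : Rel V 0ℓ} {vs} → IsCycle A vs →
                  ∃₂ λ a b → ∃ λ d → a ≢ b × a ≢ d × b ≢ d × a ∈ vs × b ∈ vs × d ∈ vs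
  isCycle-three {vs = a ∷ b ∷ d ∷ _} (_ , ((a≢b ∷ a≢d ∷ _) ∷ (b≢d ∷ _) ∷ _) , _) =
    a , b , d , a≢b , a≢d , b≢d , here refl , there (here refl) , there (there (here refl))
  isCycle-three {vs = _ ∷ []}     (s≤s () , _)
  isCycle-three {vs = _ ∷ _ ∷ []} (s≤s (s≤s ()) , _)

  walk-tabulate : ∀ {A : Rel V 0ℓ} k (g : Fin (suc k) → V) t →
                  (∀ (i : Fin k) → A (g (inject₁ i)) (g (suc i))) → A (g (fromℕ k)) t →
                  Walk A (g zero) (tabulate (g ∘ suc) ∷ʳ t)
  walk-tabulate zero    g t step close = close , tt
  walk-tabulate (suc k) g t step close = step zero , walk-tabulate k (g ∘ suc) t (step ∘ suc) close

  walk-lookup : ∀ {A : Rel V 0ℓ} a l t → Walk A a (l ∷ʳ t) →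
                (∀ (i : Fin (length l)) → A (lookup (a ∷ l) (inject₁ i)) (lookup l i)) ×
                A (lookup (a ∷ l) (fromℕ (length l))) t
  walk-lookup a []      t (e , _) = (λ ()) , e
  walk-lookup a (b ∷ l) t (e , p) =
    let (step , close) = walk-lookup b l t p in (λ { zero → e ; (suc i) → step i }) , close

  unique-lookup-injective : ∀ {xs : List V} → Unique xs → ∀ {i j} → lookup xs i ≡ lookup xs j → i ≡ j
  unique-lookup-injective (x≢ ∷ u) {zero}  {zero}  _ = refl
  unique-lookup-injective (x≢ ∷ u) {zero}  {suc j} p = ⊥-elim (All.lookup x≢ (∈-lookup j) p)
  unique-lookup-injective (x≢ ∷ u) {suc i} {zero}  p = ⊥-elim (All.lookup x≢ (∈-lookup i) (sym p))
  unique-lookup-injective (x≢ ∷ u) {suc i} {suc j} p = cong suc (unique-lookup-injective u p)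

  CliqueAt : Rel V 0ℓ → V → Set
  CliqueAt A u = ∀ x y → Star A u x → Star A u y → x ≢ y → A x y

  AcyclicAt : Rel V 0ℓ → V → Set
  AcyclicAt A u = ∀ vs → IsCycle A vs → All (Star A u) vs → ⊥

  CliqueOrTree : Pred V 0ℓ → Rel V 0ℓ → Set
  CliqueOrTree W A = ∀ u → W u → CliqueAt A u ⊎ AcyclicAt A u

  acyclicAt-small : ∀ {A : Rel V 0ℓ} {u s} {K : Pred V 0ℓ} → (∀ {z₁ z₂} → K z₁ → K z₂ → z₁ ≡ z₂) →
                    (∀ {z} → Star A u z → z ≡ s ⊎ K z) → AcyclicAt A u
  acyclicAt-small {s = s} {K} K-prop small vs c reach with isCycle-three c
  ... | a , b , d , a≢b , a≢d , b≢d , a∈ , b∈ , d∈ =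
    at-most-two a≢b a≢d b≢d (small (All.lookup reach a∈)) (small (All.lookup reach b∈)) (small (All.lookup reach d∈))
    where
    at-most-two : ∀ {a b d} → a ≢ b → a ≢ d → b ≢ d → a ≡ s ⊎ K a → b ≡ s ⊎ K b → d ≡ s ⊎ K d → ⊥
    at-most-two a≢b _   _   (inj₁ a≡s) (inj₁ b≡s) _          = a≢b (trans a≡s (sym b≡s))
    at-most-two _   a≢d _   (inj₁ a≡s) (inj₂ _)   (inj₁ d≡s) = a≢d (trans a≡s (sym d≡s))
    at-most-two _   _   b≢d (inj₁ _)   (inj₂ Kb)  (inj₂ Kd)  = b≢d (K-prop Kb Kd)
    at-most-two _   _   b≢d (inj₂ _)   (inj₁ b≡s) (inj₁ d≡s) = b≢d (trans b≡s (sym d≡s))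
    at-most-two _   a≢d _   (inj₂ Ka)  (inj₁ _)   (inj₂ Kd)  = a≢d (K-prop Ka Kd)
    at-most-two a≢b _   _   (inj₂ Ka)  (inj₂ Kb)  _          = a≢b (K-prop Ka Kb)

  cliqueOrTree-induced : ∀ {W W′ : Pred V 0ℓ} {A A′ : Rel V 0ℓ} →
    (∀ {z} → W′ z → W z) → A′ ⇒ A → (∀ {a b} → W′ a → W′ b → A a b → A′ a b) →
    (∀ {a b} → A′ a b → W′ b) → CliqueOrTree W A → CliqueOrTree W′ A′
  cliqueOrTree-induced {A = A} {A′} W′⊆W A′⇒A A⇒A′ A′-presʳ good u W′u with good u (W′⊆W W′u)
  ... | inj₁ clique = inj₁ λ x y ux uy x≢y →
          A⇒A′ (Star-closed A′-presʳ W′u ux) (Star-closed A′-presʳ W′u uy)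
               (clique x y (Star.map A′⇒A ux) (Star.map A′⇒A uy) x≢y)
  ... | inj₂ acyc = inj₂ λ vs c reach → acyc vs (isCycle-map⇒ A′⇒A c) (All.map (Star.map A′⇒A) reach)

-- H′ = (W′, A′) is H = (W, A) with the vertex w deleted and possibly some edges added.
module VertexRemoval {V : Set} (_≟_ : DecidableEquality V)
  {W W′ : Pred V 0ℓ} {A A′ : Rel V 0ℓ} (w : V)
  (A-sym : Symmetric A) (A′-sym : Symmetric A′) (A′-presʳ : ∀ {a b} → A′ a b → W′ b)
  (W′⊆W : ∀ {z} → W′ z → W z) (W′-≢w : ∀ {z} → W′ z → z ≢ w) (W⊆W′ : ∀ {z} → W z → z ≢ w → W′ z)
  (A⇒A′ : ∀ {a b} → A a b → a ≢ w → b ≢ w → A′ a b)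
  where

  open DecMembership _≟_ using (_∈?_)

  restrict : A′ ⇒ A → CliqueOrTree W A → CliqueOrTree W′ A′
  restrict A′⇒A = cliqueOrTree-induced W′⊆W A′⇒A (λ Wa Wb e → A⇒A′ e (W′-≢w Wa) (W′-≢w Wb)) A′-presʳ

  module Isolated (isolated : ∀ {z} → ¬ A w z) (A′⇒A : A′ ⇒ A) where

    A⇒A′-everywhere : A ⇒ A′
    A⇒A′-everywhere e = A⇒A′ e (λ { refl → isolated e }) (λ { refl → isolated (A-sym e) })

    alone : ∀ {z} → Star A w z → z ≡ w
    alone ε       = refl
    alone (e ◅ _) = ⊥-elim (isolated e)

    reflects : CliqueOrTree W′ A′ → CliqueOrTree W A
    reflects good u Wu with u ≟ w
    ... | yes refl = inj₁ λ x y wx wy x≢y → ⊥-elim (x≢y (trans (alone wx) (sym (alone wy))))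
    ... | no u≢w with good u (W⊆W′ Wu u≢w)
    ...   | inj₁ clique = inj₁ λ x y ux uy x≢y →
              A′⇒A (clique x y (Star.map A⇒A′-everywhere ux) (Star.map A⇒A′-everywhere uy) x≢y)
    ...   | inj₂ acyc = inj₂ λ vs c reach →
              acyc vs (isCycle-map⇒ A⇒A′-everywhere c) (All.map (Star.map A⇒A′-everywhere) reach)

    cliqueOrTree⇔ : CliqueOrTree W A ⇔ CliqueOrTree W′ A′
    cliqueOrTree⇔ = mk⇔ (restrict A′⇒A) reflects

  -- Backwards, w is collapsed onto a surviving vertex c.
  module Collapse (c : V) (c≢w : c ≢ w) (W′c : W′ c)
    (from-w : ∀ {z} → A w z → Star A′ c z)
    (A′⇒A-off-c : ∀ {a b} → A′ a b → a ≢ c → b ≢ c → A a b)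
    where

    collapse : V → V
    collapse z with z ≟ w
    ... | yes _ = c
    ... | no  _ = z

    collapse-w : collapse w ≡ c
    collapse-w with w ≟ w
    ... | yes _   = refl
    ... | no  w≢w = ⊥-elim (w≢w refl)

    collapse-≢w : ∀ {z} → z ≢ w → collapse z ≡ z
    collapse-≢w {z} z≢w with z ≟ w
    ... | yes z≡w = ⊥-elim (z≢w z≡w)
    ... | no  _   = refl

    collapse-W′ : ∀ {u} → W u → W′ (collapse u)
    collapse-W′ {u} Wu with u ≟ w
    ... | yes _   = W′c
    ... | no  u≢w = W⊆W′ Wu u≢w

    no-loop : ¬ A w w
    no-loop e = unreachable (from-w e)
      where
      unreachable : ¬ Star A′ c w
      unreachable ε       = c≢w refl
      unreachable (e ◅ s) = W′-≢w (Star-closed A′-presʳ (A′-presʳ e) s) refl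

    to-w : ∀ {z} → A z w → Star A′ z c
    to-w e = reverse A′-sym (from-w (A-sym e))

    collapse-step : ∀ {a b} → A a b → Star A′ (collapse a) (collapse b)
    collapse-step {a} {b} e with a ≟ w | b ≟ w
    ... | yes refl | yes refl = ⊥-elim (no-loop e)
    ... | yes refl | no _     = from-w e
    ... | no _     | yes refl = to-w e
    ... | no a≢w   | no b≢w   = A⇒A′ e a≢w b≢w ◅ ε

    collapse-star : ∀ {a b} → Star A a b → Star A′ (collapse a) (collapse b)
    collapse-star = kleisliStar collapse collapse-step

    collapse-star-≢w : ∀ {u z} → z ≢ w → Star A u z → Star A′ (collapse u) z
    collapse-star-≢w z≢w s = subst (Star A′ _) (collapse-≢w z≢w) (collapse-star s)

    NoCycleThrough-w : V → Set
    NoCycleThrough-w u = ∀ r → IsCycle A (w ∷ r) → All (Star A u) (w ∷ r) → ⊥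

    acyclicAt-lift : ∀ {u} → NoCycleThrough-w u → AcyclicAt A′ (collapse u) → AcyclicAt A u
    acyclicAt-lift through-w acyc vs c reach with w ∈? vs
    ... | yes w∈ with isCycle-rotateTo w∈ c
    ...   | r , c′ , ⊆vs = through-w r c′ (All.anti-mono ⊆vs reach)
    acyclicAt-lift through-w acyc vs c reach | no w∉ =
      acyc vs (isCycle-map (λ a≢w b≢w e → A⇒A′ e a≢w b≢w) (∉⇒All≢ w∉) c)
              (All.zipWith (λ (z≢w , s) → collapse-star-≢w z≢w s) (∉⇒All≢ w∉ , reach))

    module _ {u} (c-unreachable : ¬ Star A′ (collapse u) c) where

      reach-avoids-w : ∀ {z} → Star A u z → z ≢ w
      reach-avoids-w s refl with Star-unsnoc s
      ... | inj₁ refl = c-unreachable (subst (λ t → Star A′ t c) (sym collapse-w) ε)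
      ... | inj₂ (z , s′ , e) = c-unreachable (collapse-star-≢w (λ { refl → no-loop e }) s′ ◅◅ to-w e)

      cliqueAt-lift : CliqueAt A′ (collapse u) → CliqueAt A u
      cliqueAt-lift clique x y ux uy x≢y =
        A′⇒A-off-c (clique x y (reach ux) (reach uy) x≢y) (avoids-c ux) (avoids-c uy)
        where
        reach : ∀ {z} → Star A u z → Star A′ (collapse u) z
        reach s = collapse-star-≢w (reach-avoids-w s) s
        avoids-c : ∀ {z} → Star A u z → z ≢ c
        avoids-c s refl = c-unreachable (reach s)

    cliqueAt-reaches-c? : Decidable A′ → ∀ {t} → CliqueAt A′ t → Dec (Star A′ t c)
    cliqueAt-reaches-c? A′? {t} clique with t ≟ c
    ... | yes refl = yes ε
    ... | no  t≢c  = Dec.map′ (_◅ ε) (λ s → clique t c ε s t≢c) (A′? t c)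

    -- By the hypothesis on K, a clique of H′ through c has at most two vertices, so it is still a tree
    -- after w is reattached.
    reflects : Decidable A′ → {K : Pred V 0ℓ} → (∀ {z₁ z₂} → K z₁ → K z₂ → z₁ ≡ z₂) →
               (∀ {t} → CliqueAt A′ t → Star A′ t c → ∀ {z} → Star A′ t z → z ≡ c ⊎ K z) →
               (∀ {u} → AcyclicAt A′ (collapse u) → NoCycleThrough-w u) →
               CliqueOrTree W′ A′ → CliqueOrTree W A
    reflects A′? K-prop small through-w good u Wu with good (collapse u) (collapse-W′ Wu)
    ... | inj₂ acyc = inj₂ (acyclicAt-lift (through-w acyc) acyc)
    ... | inj₁ clique with cliqueAt-reaches-c? A′? clique
    ...   | no  c-unreachable = inj₁ (cliqueAt-lift c-unreachable clique)
    ...   | yes reaches-c     = inj₂ (acyclicAt-lift (through-w acyc) acyc)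
      where
      acyc : AcyclicAt A′ (collapse u)
      acyc = acyclicAt-small K-prop (small clique reaches-c)

  module Pendant (c : V) (W′c : W′ c) (only-c : ∀ {z} → A w z → z ≡ c) (A′⇒A : A′ ⇒ A)
    (c-leaf : ∀ {z₁ z₂} → A′ c z₁ → A′ c z₂ → z₁ ≡ z₂) (A′? : Decidable A′)
    where

    open Collapse c (W′-≢w W′c) W′c (λ e → subst (Star A′ c) (sym (only-c e)) ε) (λ e _ _ → A′⇒A e)

    clique-through-c : ∀ {t} → CliqueAt A′ t → Star A′ t c → ∀ {z} → Star A′ t z → z ≡ c ⊎ A′ c z
    clique-through-c clique tc {z} tz with z ≟ c
    ... | yes z≡c = inj₁ z≡c
    ... | no  z≢c = inj₂ (clique c z tc tz (z≢c ∘ sym))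

    no-cycle-through-w : ∀ {u} → NoCycleThrough-w u
    no-cycle-through-w (r₁ ∷ b ∷ l) (_ , (_ ∷ r₁≢ ∷ _) , e₀ , p) _ =
      ≢-walkEnd b l r₁≢ (trans (only-c e₀) (sym (only-c (A-sym (proj₂ (walk-∷ʳ⁻ r₁ (b ∷ l) p))))))
    no-cycle-through-w []      (s≤s () , _)        _
    no-cycle-through-w (_ ∷ []) (s≤s (s≤s ()) , _) _

    cliqueOrTree⇔ : CliqueOrTree W A ⇔ CliqueOrTree W′ A′
    cliqueOrTree⇔ = mk⇔ (restrict A′⇒A) (reflects A′? c-leaf clique-through-c (λ _ → no-cycle-through-w))

  module Suppressed (x y : V) (W′x : W′ x) (x≢y : x ≢ y)
    (A-wx : A w x) (A-wy : A w y) (only-xy : ∀ {z} → A w z → z ≡ x ⊎ z ≡ y)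
    (A′⇒A-or-xy : ∀ {a b} → A′ a b → A a b ⊎ (a ≡ x × b ≡ y) ⊎ (a ≡ y × b ≡ x))
    (A′-xy : A′ x y) (¬A-xy : ¬ A x y) (no-common : ∀ {z} → A′ x z → A′ y z → ⊥) (A′? : Decidable A′)
    where

    x≢w : x ≢ w
    x≢w = W′-≢w W′x

    A′⇒A-off-x : ∀ {a b} → A′ a b → a ≢ x → b ≢ x → A a b
    A′⇒A-off-x e a≢x b≢x with A′⇒A-or-xy e
    ... | inj₁ e′                = e′
    ... | inj₂ (inj₁ (a≡x , _)) = ⊥-elim (a≢x a≡x)
    ... | inj₂ (inj₂ (_ , b≡x)) = ⊥-elim (b≢x b≡x)

    A′⇒A-off-y : ∀ {a b} → A′ a b → a ≢ y → b ≢ y → A a b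
    A′⇒A-off-y e a≢y b≢y with A′⇒A-or-xy e
    ... | inj₁ e′                = e′
    ... | inj₂ (inj₁ (_ , b≡y)) = ⊥-elim (b≢y b≡y)
    ... | inj₂ (inj₂ (a≡y , _)) = ⊥-elim (a≢y a≡y)

    expand-step : A′ ⇒ Star A
    expand-step e with A′⇒A-or-xy e
    ... | inj₁ e′                  = e′ ◅ ε
    ... | inj₂ (inj₁ (refl , refl)) = A-sym A-wx ◅ A-wy ◅ ε
    ... | inj₂ (inj₂ (refl , refl)) = A-sym A-wy ◅ A-wx ◅ ε

    expand : Star A′ ⇒ Star A
    expand = expand-step ⋆

    -- A cycle of H′ through x uses the edge xy iff y is one of the two cycle-neighbours of x;
    -- then w is put back on that edge.
    insert-w : ∀ {P : Pred V 0ℓ} r → IsCycle A′ (x ∷ r) → All W′ (x ∷ r) → All P (x ∷ r) → P w →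
               ∃ λ vs → IsCycle A vs × All P vs
    insert-w []       (s≤s () , _)        _ _ _
    insert-w (_ ∷ []) (s≤s (s≤s ()) , _) _ _ _
    insert-w {P} (r₁ ∷ rest@(b ∷ l)) (len , (x≢ ∷ r₁≢ ∷ uniq) , e₀ , p) (W′x ∷ W′r) (Px ∷ Pr) Pw =
      by-cases (r₁ ≟ y) (walkEnd b l ≟ y)
      where
      split : Walk A′ r₁ rest × A′ (walkEnd b l) x
      split = walk-∷ʳ⁻ r₁ rest p
      walk-A : Walk A r₁ rest
      walk-A = walk-map (λ a≢x b≢x e → A′⇒A-off-x e (≢-sym a≢x) (≢-sym b≢x)) rest (All.head x≢) (All.tail x≢)
                        (proj₁ split)
      by-cases : Dec (r₁ ≡ y) → Dec (walkEnd b l ≡ y) → ∃ λ vs → IsCycle A vs × All P vs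
      by-cases (yes r₁≡y) _ =
        x ∷ w ∷ r₁ ∷ rest ,
        (s≤s (s≤s (s≤s z≤n)) , ((x≢w ∷ x≢) ∷ All.map (≢-sym ∘ W′-≢w) W′r ∷ r₁≢ ∷ uniq) ,
         A-sym A-wx , subst (A w) (sym r₁≡y) A-wy ,
         walk-∷ʳ⁺ r₁ rest walk-A (A′⇒A-off-y (proj₂ split) (≢-walkEnd b l r₁≢ ∘ trans r₁≡y ∘ sym) x≢y)) ,
        Px ∷ Pw ∷ Pr
      by-cases (no r₁≢y) (yes lst≡y) =
        (x ∷ r₁ ∷ rest) ∷ʳ w ,
        (s≤s (s≤s (s≤s z≤n)) , unique-∷ʳ⁺ (x≢ ∷ r₁≢ ∷ uniq) (All.map W′-≢w (W′x ∷ W′r)) ,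
         A′⇒A-off-y e₀ x≢y r₁≢y ,
         walk-∷ʳ⁺ r₁ (rest ∷ʳ w) (walk-∷ʳ⁺ r₁ rest walk-A (subst (λ t → A t w) (sym lst≡y) (A-sym A-wy)))
                  (subst (λ t → A t x) (sym (walkEnd-∷ʳ r₁ rest w)) A-wx)) ,
        All.∷ʳ⁺ (Px ∷ Pr) Pw
      by-cases (no r₁≢y) (no lst≢y) =
        x ∷ r₁ ∷ rest ,
        (len , (x≢ ∷ r₁≢ ∷ uniq) , A′⇒A-off-y e₀ x≢y r₁≢y , walk-∷ʳ⁺ r₁ rest walk-A (A′⇒A-off-y (proj₂ split) lst≢y x≢y)) ,
        Px ∷ Pr

    preserves : CliqueOrTree W A → CliqueOrTree W′ A′
    preserves good u W′u = Sum.map clique′ acyclic′ (good u (W′⊆W W′u))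
      where
      in-W′ : ∀ {z} → Star A′ u z → W′ z
      in-W′ = Star-closed A′-presʳ W′u

      clique′ : CliqueAt A u → CliqueAt A′ u
      clique′ clique p q up uq p≢q =
        A⇒A′ (clique p q (expand up) (expand uq) p≢q) (W′-≢w (in-W′ up)) (W′-≢w (in-W′ uq))

      acyclic′ : AcyclicAt A u → AcyclicAt A′ u
      acyclic′ acyc vs c reach with x ∈? vs
      ... | no x∉ = acyc vs (isCycle-map (λ a≢x b≢x e → A′⇒A-off-x e a≢x b≢x) (∉⇒All≢ x∉) c) (All.map expand reach)
      ... | yes x∈ =
        let (r , c′ , ⊆vs) = isCycle-rotateTo x∈ c
            reach′ : All (Star A′ u) (x ∷ r)
            reach′ = All.anti-mono ⊆vs reach
            (vs₂ , c₂ , reach₂) = insert-w r c′ (All.map in-W′ reach′) (All.map expand reach′)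
                                           (expand (All.head reach′) ◅◅ A-sym A-wx ◅ ε)
        in acyc vs₂ c₂ reach₂

    from-w : ∀ {z} → A w z → Star A′ x z
    from-w e with only-xy e
    ... | inj₁ refl = ε
    ... | inj₂ refl = A′-xy ◅ ε

    open Collapse x x≢w W′x from-w A′⇒A-off-x

    clique-through-x : ∀ {t} → CliqueAt A′ t → Star A′ t x → ∀ {z} → Star A′ t z → z ≡ x ⊎ z ≡ y
    clique-through-x clique tx {z} tz with z ≟ x | z ≟ y
    ... | yes z≡x | _       = inj₁ z≡x
    ... | no _    | yes z≡y = inj₂ z≡y
    ... | no z≢x  | no z≢y  = ⊥-elim (no-common (clique x z tx tz (z≢x ∘ sym))
                                               (clique y z (tx ◅◅ A′-xy ◅ ε) tz (z≢y ∘ sym)))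

    neighbours-of-w : ∀ {s t} → s ≢ t → s ≡ x ⊎ s ≡ y → t ≡ x ⊎ t ≡ y → A′ s t × ¬ A s t
    neighbours-of-w s≢t (inj₁ refl) (inj₁ refl) = ⊥-elim (s≢t refl)
    neighbours-of-w s≢t (inj₁ refl) (inj₂ refl) = A′-xy , ¬A-xy
    neighbours-of-w s≢t (inj₂ refl) (inj₁ refl) = A′-sym A′-xy , ¬A-xy ∘ A-sym
    neighbours-of-w s≢t (inj₂ refl) (inj₂ refl) = ⊥-elim (s≢t refl)

    no-cycle-through-w : ∀ {u} → AcyclicAt A′ (collapse u) → NoCycleThrough-w u
    no-cycle-through-w _ []       (s≤s () , _)        _
    no-cycle-through-w _ (_ ∷ []) (s≤s (s≤s ()) , _) _
    no-cycle-through-w _ (r₁ ∷ b ∷ []) (_ , (_ ∷ (r₁≢b ∷ []) ∷ _) , e₀ , e , eₗ , _) _ =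
      proj₂ (neighbours-of-w r₁≢b (only-xy e₀) (only-xy (A-sym eₗ))) e
    no-cycle-through-w acyc (r₁ ∷ rest@(b ∷ _ ∷ l)) (_ , (w≢ ∷ r₁≢ ∷ uniq) , e₀ , p) (_ ∷ reach) =
      acyc (r₁ ∷ rest) (s≤s (s≤s (s≤s z≤n)) , r₁≢ ∷ uniq , walk-∷ʳ⁺ r₁ rest walk′ closing)
           (All.zipWith (λ (z≢w , s) → collapse-star-≢w z≢w s) (avoid-w , reach))
      where
      avoid-w : All (_≢ w) (r₁ ∷ rest)
      avoid-w = All.map ≢-sym w≢
      split : Walk A r₁ rest × A (walkEnd r₁ rest) w
      split = walk-∷ʳ⁻ r₁ rest p
      walk′ : Walk A′ r₁ rest
      walk′ = walk-map (λ a≢w b≢w e → A⇒A′ e a≢w b≢w) rest (All.head avoid-w) (All.tail avoid-w) (proj₁ split)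
      closing : A′ (walkEnd r₁ rest) r₁
      closing = proj₁ (neighbours-of-w (≢-sym (≢-walkEnd b _ r₁≢)) (only-xy (A-sym (proj₂ split))) (only-xy e₀))

    cliqueOrTree⇔ : CliqueOrTree W A ⇔ CliqueOrTree W′ A′
    cliqueOrTree⇔ = mk⇔ preserves (reflects A′? (λ p q → trans p (sym q)) clique-through-x no-cycle-through-w)

module _ {n : ℕ} where

  joins-sym : ∀ {e : Edge n} {a b} → Joins e a b → Joins e b a
  joins-sym = Sum.swap

  joins-functional : ∀ {e : Edge n} {a b c} → Joins e a b → Joins e a c → b ≡ c
  joins-functional (inj₁ (refl , refl)) (inj₁ (refl , refl)) = refl
  joins-functional (inj₁ (refl , refl)) (inj₂ (refl , refl)) = refl
  joins-functional (inj₂ (refl , refl)) (inj₁ (refl , refl)) = refl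
  joins-functional (inj₂ (refl , refl)) (inj₂ (refl , refl)) = refl

  joins-endpoints : ∀ {e e′ : Edge n} {x y} → Joins e x y → Joins e′ x y → Joins e′ (proj₁ e) (proj₂ e)
  joins-endpoints (inj₁ (refl , refl)) j = j
  joins-endpoints (inj₂ (refl , refl)) j = joins-sym j

  Incident : Fin n → Edge n → Set
  Incident v e = proj₁ e ≡ v ⊎ proj₂ e ≡ v

  joins-incident : ∀ {e : Edge n} {a b} → Joins e a b → Incident a e
  joins-incident (inj₁ (p , _)) = inj₁ p
  joins-incident (inj₂ (_ , q)) = inj₂ q

  joins? : ∀ (e : Edge n) a b → Dec (Joins e a b)
  joins? e a b = (proj₁ e ≟ a ×-dec proj₂ e ≟ b) ⊎-dec (proj₁ e ≟ b ×-dec proj₂ e ≟ a)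

  module _ {W : Pred (Fin n) 0ℓ} where

    live-intro : ∀ {e : Edge n} {a b} → W a → W b → Joins e a b → Live W e
    live-intro Wa Wb (inj₁ (refl , refl)) = Wa , Wb
    live-intro Wa Wb (inj₂ (refl , refl)) = Wb , Wa

    live-presʳ : ∀ {e : Edge n} {a b} → Live W e → Joins e a b → W b
    live-presʳ (_ , W₂) (inj₁ (_ , refl)) = W₂
    live-presʳ (W₁ , _) (inj₂ (refl , _)) = W₁

    adj-sym : ∀ {E} → Symmetric (Adj W E)
    adj-sym = Any.map (Product.map₂ joins-sym)

    adj-presʳ : ∀ {E a b} → Adj W E a b → W b
    adj-presʳ p = let (_ , live , j) = Any.satisfied p in live-presʳ live j

    adj-presˡ : ∀ {E a b} → Adj W E a b → W a
    adj-presˡ p = adj-presʳ (adj-sym p)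

    adj? : (∀ z → Dec (W z)) → ∀ E → Decidable (Adj W E)
    adj? W? E a b = Any.any? (λ e → (W? (proj₁ e) ×-dec W? (proj₂ e)) ×-dec joins? e a b) E

    adj-++⁺ˡ : ∀ {E F a b} → Adj W E a b → Adj W (E ++ F) a b
    adj-++⁺ˡ = Any.++⁺ˡ

    adj-∷ʳ⁺ : ∀ E {e a b} → Live W e → Joins e a b → Adj W (E ∷ʳ e) a b
    adj-∷ʳ⁺ E live j = Any.++⁺ʳ E (here (live , j))

    adj-∷ʳ⁻ : ∀ E {e a b} → Adj W (E ∷ʳ e) a b → Adj W E a b ⊎ (Live W e × Joins e a b)
    adj-∷ʳ⁻ E p = Sum.map₂ Any.singleton⁻ (Any.++⁻ E p)

  adj-restrict : ∀ {W W′ : Pred (Fin n) 0ℓ} {E a b} → W′ a → W′ b → Adj W E a b → Adj W′ E a b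
  adj-restrict W′a W′b = Any.map λ (_ , j) → live-intro W′a W′b j , j

  adj-mono : ∀ {W W′ : Pred (Fin n) 0ℓ} {E a b} → (∀ {z} → W z → W′ z) → Adj W E a b → Adj W′ E a b
  adj-mono W⊆W′ p = adj-restrict (W⊆W′ (adj-presˡ p)) (W⊆W′ (adj-presʳ p)) p

  any-index : ∀ {P : Pred (Edge n) 0ℓ} {E} → Any P E → ∃ λ i → P (lookupE E i)
  any-index (here p)  = zero , p
  any-index (there p) = let (i , Pi) = any-index p in suc i , Pi

  inject : ∀ (E : List (Edge n)) e → Fin (length E) → Fin (length (E ∷ʳ e))
  inject (_ ∷ E) e zero    = zero
  inject (_ ∷ E) e (suc i) = suc (inject E e i)

  last : ∀ (E : List (Edge n)) e → Fin (length (E ∷ʳ e))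
  last []      e = zero
  last (_ ∷ E) e = suc (last E e)

  lookupE-inject : ∀ E e i → lookupE (E ∷ʳ e) (inject E e i) ≡ lookupE E i
  lookupE-inject (_ ∷ E) e zero    = refl
  lookupE-inject (_ ∷ E) e (suc i) = lookupE-inject E e i

  lookupE-last : ∀ E e → lookupE (E ∷ʳ e) (last E e) ≡ e
  lookupE-last []      e = refl
  lookupE-last (_ ∷ E) e = lookupE-last E e

  index-∷ʳ : ∀ E e (i : Fin (length (E ∷ʳ e))) → (∃ λ j → i ≡ inject E e j) ⊎ i ≡ last E e
  index-∷ʳ []      e zero    = inj₂ refl
  index-∷ʳ (_ ∷ E) e zero    = inj₁ (zero , refl)
  index-∷ʳ (_ ∷ E) e (suc i) = Sum.map (Product.map suc (cong suc)) (cong suc) (index-∷ʳ E e i)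

  inject-injective : ∀ E e {i j} → inject E e i ≡ inject E e j → i ≡ j
  inject-injective (_ ∷ E) e {zero}  {zero}  _ = refl
  inject-injective (_ ∷ E) e {suc i} {suc j} p = cong suc (inject-injective E e (suc-injective p))

  module Count {P : Pred (Edge n) 0ℓ} (P? : U.Decidable P) where

    count : List (Edge n) → ℕ
    count E = length (filter P? E)

    count-∷ : ∀ e E → count E ≤ count (e ∷ E)
    count-∷ e E = by-cases (P? e)
      where
      by-cases : Dec (P e) → count E ≤ count (e ∷ E)
      by-cases (yes Pe) = subst (λ l → count E ≤ length l) (sym (filter-accept P? {e} {E} Pe)) (n≤1+n _)
      by-cases (no ¬Pe) = subst (λ l → count E ≤ length l) (sym (filter-reject P? {e} {E} ¬Pe)) ≤-refl

    count-accept : ∀ {e} E → P e → count (e ∷ E) ≡ suc (count E)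
    count-accept {e} E Pe = cong length (filter-accept P? {e} {E} Pe)

    count-≥1 : ∀ E i → P (lookupE E i) → 1 ≤ count E
    count-≥1 (e ∷ E) zero    Pi = subst (1 ≤_) (sym (count-accept E Pi)) (s≤s z≤n)
    count-≥1 (e ∷ E) (suc i) Pi = ≤-trans (count-≥1 E i Pi) (count-∷ e E)

    count-≥2 : ∀ E i j → i ≢ j → P (lookupE E i) → P (lookupE E j) → 2 ≤ count E
    count-≥2 (e ∷ E) zero    zero    i≢j _  _  = ⊥-elim (i≢j refl)
    count-≥2 (e ∷ E) zero    (suc j) _   Pi Pj = subst (2 ≤_) (sym (count-accept E Pi)) (s≤s (count-≥1 E j Pj))
    count-≥2 (e ∷ E) (suc i) zero    _   Pi Pj = subst (2 ≤_) (sym (count-accept E Pj)) (s≤s (count-≥1 E i Pi))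
    count-≥2 (e ∷ E) (suc i) (suc j) i≢j Pi Pj = ≤-trans (count-≥2 E i j (i≢j ∘ cong suc) Pi Pj) (count-∷ e E)

    count-≥3 : ∀ E i j k → i ≢ j → i ≢ k → j ≢ k →
               P (lookupE E i) → P (lookupE E j) → P (lookupE E k) → 3 ≤ count E
    count-≥3 (e ∷ E) zero zero _ i≢j _ _ _ _ _ = ⊥-elim (i≢j refl)
    count-≥3 (e ∷ E) zero (suc j) zero _ i≢k _ _ _ _ = ⊥-elim (i≢k refl)
    count-≥3 (e ∷ E) zero (suc j) (suc k) _ _ j≢k Pi Pj Pk =
      subst (3 ≤_) (sym (count-accept E Pi)) (s≤s (count-≥2 E j k (j≢k ∘ cong suc) Pj Pk))
    count-≥3 (e ∷ E) (suc i) zero zero _ _ j≢k _ _ _ = ⊥-elim (j≢k refl)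
    count-≥3 (e ∷ E) (suc i) zero (suc k) _ i≢k _ Pi Pj Pk =
      subst (3 ≤_) (sym (count-accept E Pj)) (s≤s (count-≥2 E i k (i≢k ∘ cong suc) Pi Pk))
    count-≥3 (e ∷ E) (suc i) (suc j) zero i≢j _ _ Pi Pj Pk =
      subst (3 ≤_) (sym (count-accept E Pk)) (s≤s (count-≥2 E i j (i≢j ∘ cong suc) Pi Pj))
    count-≥3 (e ∷ E) (suc i) (suc j) (suc k) i≢j i≢k j≢k Pi Pj Pk =
      ≤-trans (count-≥3 E i j k (i≢j ∘ cong suc) (i≢k ∘ cong suc) (j≢k ∘ cong suc) Pi Pj Pk) (count-∷ e E)

  module DegreeTwo (E : List (Edge n)) (c a b : Fin n) (deg≡2 : deg E c ≡ 2)
    (c~a : Adj AllV E c a) (c~b : Adj AllV E c b) (a≢b : a ≢ b)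
    where

    open Count (λ e → (proj₁ e ≟ c) ⊎-dec (proj₂ e ≟ c)) using (count-≥3)

    no-third-edge : ∀ i j k → i ≢ j → i ≢ k → j ≢ k →
                    Incident c (lookupE E i) → Incident c (lookupE E j) → Incident c (lookupE E k) → ⊥
    no-third-edge i j k i≢j i≢k j≢k Ii Ij Ik =
      <-irrefl refl (subst (3 ≤_) deg≡2 (count-≥3 E i j k i≢j i≢k j≢k Ii Ij Ik))

    index≢ : ∀ {i k s t} → Joins (lookupE E i) c s → Joins (lookupE E k) c t → s ≢ t → i ≢ k
    index≢ ji jk s≢t refl = s≢t (joins-functional ji jk)

    i-a i-b : Fin (length E)
    i-a = proj₁ (any-index c~a)
    i-b = proj₁ (any-index c~b)
    j-a : Joins (lookupE E i-a) c a
    j-a = proj₂ (proj₂ (any-index c~a))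
    j-b : Joins (lookupE E i-b) c b
    j-b = proj₂ (proj₂ (any-index c~b))

    incident-edge : ∀ i → Incident c (lookupE E i) → Joins (lookupE E i) c a ⊎ Joins (lookupE E i) c b
    incident-edge i Ii with joins? (lookupE E i) c a | joins? (lookupE E i) c b
    ... | yes ja | _      = inj₁ ja
    ... | no _   | yes jb = inj₂ jb
    ... | no ¬ja | no ¬jb = ⊥-elim (no-third-edge i-a i-b i (index≢ j-a j-b a≢b)
                              (λ { refl → ¬ja j-a }) (λ { refl → ¬jb j-b })
                              (joins-incident j-a) (joins-incident j-b) Ii)

    neighbour : ∀ {W : Pred (Fin n) 0ℓ} {z} → Adj W E c z → z ≡ a ⊎ z ≡ b
    neighbour p with any-index p
    ... | i , _ , jz = Sum.map (joins-functional jz) (joins-functional jz) (incident-edge i (joins-incident jz))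

    no-loop : c ≢ a → c ≢ b → ∀ i → ¬ Joins (lookupE E i) c c
    no-loop c≢a c≢b i jc = Sum.[ c≢a ∘ joins-functional jc , c≢b ∘ joins-functional jc ] (incident-edge i (joins-incident jc))

    no-parallel : ∀ i j {t} → i ≢ j → Joins (lookupE E i) c t → Joins (lookupE E j) c t → ⊥
    no-parallel i j {t} i≢j ji jj with incident-edge i (joins-incident ji)
    ... | inj₁ ja = no-third-edge i j i-b i≢j (index≢ ji j-b t≢b) (index≢ jj j-b t≢b)
                      (joins-incident ji) (joins-incident jj) (joins-incident j-b)
      where
      t≢b : t ≢ b
      t≢b = λ t≡b → a≢b (trans (joins-functional ja ji) t≡b)
    ... | inj₂ jb = no-third-edge i j i-a i≢j (index≢ ji j-a t≢a) (index≢ jj j-a t≢a)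
                      (joins-incident ji) (joins-incident jj) (joins-incident j-a)
      where
      t≢a : t ≢ a
      t≢a = λ t≡a → a≢b (sym (trans (joins-functional jb ji) t≡a))

  module _ {W : Pred (Fin n) 0ℓ} {E : List (Edge n)} where

    cycle⇒isCycle : (c : Cycle W E) → IsCycle (Adj W E) (tabulate (Cycle.w c))
    cycle⇒isCycle c =
      subst (3 ≤_) (sym (length-tabulate w)) (s≤s (s≤s (s≤s z≤n))) ,
      Unique.tabulate⁺ inj ,
      walk-tabulate (suc (suc m)) w (w zero) step close
      where open Cycle c

    isCycle⇒cycle : ∀ {vs} → IsCycle (Adj W E) vs → Σ (Cycle W E) λ c → ∀ i → Cycle.w c i ∈ vs
    isCycle⇒cycle {a ∷ b ∷ d ∷ rest} (_ , u , p) =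
      let (step , close) = walk-lookup a (b ∷ d ∷ rest) a p in
      record { m = length rest ; w = lookup (a ∷ b ∷ d ∷ rest) ; inj = unique-lookup-injective u
             ; step = step ; close = close } ,
      ∈-lookup
    isCycle⇒cycle {_ ∷ []}     (s≤s () , _)
    isCycle⇒cycle {_ ∷ _ ∷ []} (s≤s (s≤s ()) , _)

    compTree⇔acyclicAt : ∀ {u} → CompTree W E u ⇔ AcyclicAt (Adj W E) u
    compTree⇔acyclicAt = mk⇔
      (λ tree vs c reach → let (c′ , ∈vs) = isCycle⇒cycle c in tree (c′ , All.lookup reach ∘ ∈vs))
      (λ acyc (c , reach) → acyc _ (cycle⇒isCycle c) (All.tabulate⁺ reach))

  goodDeletion⇔ : ∀ {V : Pred (Fin n) 0ℓ} {E S} →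
    GoodDeletion V E S ⇔ (Simple (Del V S) E × CliqueOrTree (Del V S) (Adj (Del V S) E))
  goodDeletion⇔ = mk⇔
    (Product.map₂ λ good u Wu → Sum.map₂ (Equivalence.to compTree⇔acyclicAt) (good u Wu))
    (Product.map₂ λ good u Wu → Sum.map₂ (Equivalence.from compTree⇔acyclicAt) (good u Wu))

  simple-∷ʳ⁺ : ∀ {W W′ : Pred (Fin n) 0ℓ} {E e} → Simple W E → (∀ {z} → W′ z → W z) →
               proj₁ e ≢ proj₂ e → (∀ i → ¬ Joins (lookupE E i) (proj₁ e) (proj₂ e)) → Simple W′ (E ∷ʳ e)
  simple-∷ʳ⁺ {W} {W′} {E} {e} (no-loop , no-parallel) W′⊆W e-no-loop e-new = no-loop′ , no-parallel′
    where
    at : ∀ (P : Pred (Edge n) 0ℓ) i → P (lookupE (E ∷ʳ e) (inject E e i)) → P (lookupE E i)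
    at P i = subst P (lookupE-inject E e i)
    at-last : ∀ (P : Pred (Edge n) 0ℓ) → P (lookupE (E ∷ʳ e) (last E e)) → P e
    at-last P = subst P (lookupE-last E e)
    live : ∀ {f} → Live W′ f → Live W f
    live = Product.map W′⊆W W′⊆W
    Loop : Pred (Edge n) 0ℓ
    Loop f = proj₁ f ≡ proj₂ f

    no-loop′ : ∀ i → Live W′ (lookupE (E ∷ʳ e) i) → ¬ Loop (lookupE (E ∷ʳ e) i)
    no-loop′ i l with index-∷ʳ E e i
    ... | inj₁ (j , refl) = no-loop j (live (at (Live W′) j l)) ∘ at Loop j
    ... | inj₂ refl       = e-no-loop ∘ at-last Loop

    no-parallel′ : ∀ i j a b → Live W′ (lookupE (E ∷ʳ e) i) → Live W′ (lookupE (E ∷ʳ e) j) →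
                   Joins (lookupE (E ∷ʳ e) i) a b → Joins (lookupE (E ∷ʳ e) j) a b → i ≡ j
    no-parallel′ i j a b li lj ji jj with index-∷ʳ E e i | index-∷ʳ E e j
    ... | inj₁ (i′ , refl) | inj₁ (j′ , refl) =
          cong (inject E e) (no-parallel i′ j′ a b (live (at (Live W′) i′ li)) (live (at (Live W′) j′ lj))
                                         (at (λ f → Joins f a b) i′ ji) (at (λ f → Joins f a b) j′ jj))
    ... | inj₂ refl | inj₂ refl = refl
    ... | inj₁ (i′ , refl) | inj₂ refl =
          ⊥-elim (e-new i′ (joins-endpoints (at-last (λ f → Joins f a b) jj) (at (λ f → Joins f a b) i′ ji)))
    ... | inj₂ refl | inj₁ (j′ , refl) =
          ⊥-elim (e-new j′ (joins-endpoints (at-last (λ f → Joins f a b) ji) (at (λ f → Joins f a b) j′ jj)))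

  -- Away from Z the two graphs agree, and at Z there are no loops or parallel edges.
  simple-∷ʳ⁻ : ∀ {W W′ Z : Pred (Fin n) 0ℓ} {E e} → U.Decidable Z → (∀ {z} → W z → ¬ Z z → W′ z) →
               (∀ i {z} → Z z → ¬ Joins (lookupE E i) z z) →
               (∀ i j {z t} → i ≢ j → Z z → Joins (lookupE E i) z t → Joins (lookupE E j) z t → ⊥) →
               Simple W′ (E ∷ʳ e) → Simple W E
  simple-∷ʳ⁻ {W} {W′} {Z} {E} {e} Z? to-W′ Z-no-loop Z-no-parallel (no-loop , no-parallel) =
    no-loop′ , no-parallel′
    where
    at : ∀ (P : Pred (Edge n) 0ℓ) i → P (lookupE E i) → P (lookupE (E ∷ʳ e) (inject E e i))
    at P i = subst P (sym (lookupE-inject E e i))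

    no-loop′ : ∀ i → Live W (lookupE E i) → proj₁ (lookupE E i) ≢ proj₂ (lookupE E i)
    no-loop′ i (W₁ , W₂) lo with Z? (proj₁ (lookupE E i))
    ... | yes Z₁ = Z-no-loop i Z₁ (inj₁ (refl , sym lo))
    ... | no ¬Z₁ = no-loop (inject E e i) (at (Live W′) i (to-W′ W₁ ¬Z₁ , to-W′ W₂ (¬Z₁ ∘ subst Z (sym lo))))
                           (at (λ f → proj₁ f ≡ proj₂ f) i lo)

    no-parallel′ : ∀ i j a b → Live W (lookupE E i) → Live W (lookupE E j) →
                   Joins (lookupE E i) a b → Joins (lookupE E j) a b → i ≡ j
    no-parallel′ i j a b li lj ji jj with i ≟ j
    ... | yes i≡j = i≡j
    ... | no i≢j with Z? a | Z? b
    ...   | yes Za | _      = ⊥-elim (Z-no-parallel i j i≢j Za ji jj)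
    ...   | no _   | yes Zb = ⊥-elim (Z-no-parallel i j i≢j Zb (joins-sym ji) (joins-sym jj))
    ...   | no ¬Za | no ¬Zb =
            inject-injective E e (no-parallel _ _ a b (at (Live W′) i (live-intro W′a W′b ji))
                                                      (at (Live W′) j (live-intro W′a W′b jj))
                                                      (at (λ f → Joins f a b) i ji) (at (λ f → Joins f a b) j jj))
      where
      W′a : W′ a
      W′a = to-W′ (live-presʳ li (joins-sym ji)) ¬Za
      W′b : W′ b
      W′b = to-W′ (live-presʳ li ji) ¬Zb

  ∣p[i]≔b∣≤1+∣p∣ : ∀ {m} (p : Subset m) i b → ∣ p Vec.[ i ]≔ b ∣ ≤ suc ∣ p ∣
  ∣p[i]≔b∣≤1+∣p∣ (inside  ∷ p) zero    inside  = n≤1+n _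
  ∣p[i]≔b∣≤1+∣p∣ (inside  ∷ p) zero    outside = ≤-trans (n≤1+n _) (n≤1+n _)
  ∣p[i]≔b∣≤1+∣p∣ (outside ∷ p) zero    inside  = ≤-refl
  ∣p[i]≔b∣≤1+∣p∣ (outside ∷ p) zero    outside = n≤1+n _
  ∣p[i]≔b∣≤1+∣p∣ (inside  ∷ p) (suc i) b       = s≤s (∣p[i]≔b∣≤1+∣p∣ p i b)
  ∣p[i]≔b∣≤1+∣p∣ (outside ∷ p) (suc i) b       = ∣p[i]≔b∣≤1+∣p∣ p i b

  -- Removing Z from S frees at least one slot, which x then takes.
  exchange : ∀ (S : Subset n) {Z : Pred (Fin n) 0ℓ} → U.Decidable Z → ∀ {x} → ¬ Z x → ∀ {z} → z ∈ₛ S → Z z →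
             Σ (Subset n) λ S′ → ∣ S′ ∣ ≤ ∣ S ∣ × x ∈ₛ S′ ×
                                 (∀ {t} → t ∈ₛ S′ → ¬ Z t) × (∀ {t} → t ∈ₛ S → ¬ Z t → t ∈ₛ S′)
  exchange S {Z} Z? {x} ¬Zx {z} z∈S Zz = S′ , card , x∈S′ , avoids-Z , keeps
    where
    member : Fin n → Side
    member t = if does (Z? t) then outside else Vec.lookup S t
    T S′ : Subset n
    T  = Vec.tabulate member
    S′ = T Vec.[ x ]≔ inside

    T⊆S∖Z : ∀ {t} → t ∈ₛ T → t ∈ₛ S × ¬ Z t
    T⊆S∖Z {t} t∈T = by-cases (Z? t) (trans (sym (lookup∘tabulate member t)) ([]=⇒lookup t∈T))
      where
      by-cases : (d : Dec (Z t)) → (if does d then outside else Vec.lookup S t) ≡ inside → t ∈ₛ S × ¬ Z t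
      by-cases (yes _)  ()
      by-cases (no ¬Zt) eq = lookup⇒[]= t S eq , ¬Zt

    S∖Z⊆T : ∀ {t} → t ∈ₛ S → ¬ Z t → t ∈ₛ T
    S∖Z⊆T {t} t∈S ¬Zt = lookup⇒[]= t T (trans (lookup∘tabulate member t) (by-cases (Z? t)))
      where
      by-cases : (d : Dec (Z t)) → (if does d then outside else Vec.lookup S t) ≡ inside
      by-cases (yes Zt) = ⊥-elim (¬Zt Zt)
      by-cases (no _)   = []=⇒lookup t∈S

    x∈S′ : x ∈ₛ S′
    x∈S′ = lookup⇒[]= x S′ (lookup∘update x T inside)

    S′⊆T∪x : ∀ {t} → t ∈ₛ S′ → t ≢ x → t ∈ₛ T
    S′⊆T∪x {t} t∈S′ t≢x = lookup⇒[]= t T (trans (sym (lookup∘update′ t≢x T inside)) ([]=⇒lookup t∈S′))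

    avoids-Z : ∀ {t} → t ∈ₛ S′ → ¬ Z t
    avoids-Z {t} t∈S′ with t ≟ x
    ... | yes refl = ¬Zx
    ... | no t≢x   = proj₂ (T⊆S∖Z (S′⊆T∪x t∈S′ t≢x))

    keeps : ∀ {t} → t ∈ₛ S → ¬ Z t → t ∈ₛ S′
    keeps {t} t∈S ¬Zt with t ≟ x
    ... | yes refl = x∈S′
    ... | no t≢x   = lookup⇒[]= t S′ (trans (lookup∘update′ t≢x T inside) ([]=⇒lookup (S∖Z⊆T t∈S ¬Zt)))

    card : ∣ S′ ∣ ≤ ∣ S ∣
    card = ≤-trans (∣p[i]≔b∣≤1+∣p∣ T x inside)
                   (p⊂q⇒∣p∣<∣q∣ ((proj₁ ∘ T⊆S∖Z) , z , z∈S , λ z∈T → proj₂ (T⊆S∖Z z∈T) Zz))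

module SuppressedPath {n L : ℕ} (E : List (Edge n)) (v : Fin (5 + L) → Fin n)
  (v-inj : Injective _≡_ _≡_ v)
  (v-adj : ∀ (i j : Fin (5 + L)) → suc (toℕ i) ≡ toℕ j → Adj AllV E (v i) (v j))
  (v-deg : ∀ (i : Fin (5 + L)) → 1 ≤ toℕ i → suc (toℕ i) < 5 + L → deg E (v i) ≡ 2)
  where

  ℓ : ℕ
  ℓ = 5 + L

  -- Indices beyond the path get the junk vertex v 0.
  q : ℕ → Fin n
  q i with i <? ℓ
  ... | yes i<ℓ = v (fromℕ< i<ℓ)
  ... | no  _   = v zero

  q-fromℕ< : ∀ {i} (i<ℓ : i < ℓ) → q i ≡ v (fromℕ< i<ℓ)
  q-fromℕ< {i} i<ℓ with i <? ℓ
  ... | yes _   = refl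
  ... | no  i≮ℓ = ⊥-elim (i≮ℓ i<ℓ)

  q-toℕ : ∀ i → q (toℕ i) ≡ v i
  q-toℕ i = trans (q-fromℕ< (toℕ<n i)) (cong v (fromℕ<-toℕ i (toℕ<n i)))

  q-injective : ∀ {a b} → a < ℓ → b < ℓ → q a ≡ q b → a ≡ b
  q-injective {a} {b} a<ℓ b<ℓ qa≡qb = begin
    a                  ≡⟨ toℕ-fromℕ< a<ℓ ⟨
    toℕ (fromℕ< a<ℓ)  ≡⟨ cong toℕ (v-inj (trans (sym (q-fromℕ< a<ℓ)) (trans qa≡qb (q-fromℕ< b<ℓ)))) ⟩
    toℕ (fromℕ< b<ℓ)  ≡⟨ toℕ-fromℕ< b<ℓ ⟩
    b                  ∎
    where open ≡-Reasoning

  q-≢ : ∀ {a b} → a < ℓ → b < ℓ → a ≢ b → q a ≢ q b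
  q-≢ a<ℓ b<ℓ a≢b = a≢b ∘ q-injective a<ℓ b<ℓ

  q-adj : ∀ k → suc k < ℓ → Adj AllV E (q k) (q (suc k))
  q-adj k k+1<ℓ = subst₂ (Adj AllV E) (sym (q-fromℕ< k<ℓ)) (sym (q-fromℕ< k+1<ℓ))
    (v-adj _ _ (trans (cong suc (toℕ-fromℕ< k<ℓ)) (sym (toℕ-fromℕ< k+1<ℓ))))
    where
    k<ℓ : k < ℓ
    k<ℓ = <⇒≤ k+1<ℓ

  q-deg : ∀ k → 1 ≤ k → suc k < ℓ → deg E (q k) ≡ 2
  q-deg k 1≤k k+1<ℓ = subst (λ t → deg E t ≡ 2) (sym (q-fromℕ< k<ℓ))
    (v-deg (fromℕ< k<ℓ) (subst (1 ≤_) (sym (toℕ-fromℕ< k<ℓ)) 1≤k)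
                        (subst (λ t → suc t < ℓ) (sym (toℕ-fromℕ< k<ℓ)) k+1<ℓ))
    where
    k<ℓ : k < ℓ
    k<ℓ = <⇒≤ k+1<ℓ

  module Internal (k : ℕ) (k+2<ℓ : suc (suc k) < ℓ) =
    DegreeTwo E (q (suc k)) (q k) (q (suc (suc k))) (q-deg (suc k) (s≤s z≤n) k+2<ℓ)
      (adj-sym (q-adj k (<⇒≤ k+2<ℓ))) (q-adj (suc k) k+2<ℓ) (q-≢ (<⇒≤ (<⇒≤ k+2<ℓ)) k+2<ℓ (λ ()))

  -- Removed j = {v₂, …, vⱼ} (0-indexed); Removed (ℓ ∸ 3) is Z.
  Removed : ℕ → Pred (Fin n) 0ℓ
  Removed j z = Σ (Fin ℓ) λ i → 2 ≤ toℕ i × toℕ i ≤ j × v i ≡ z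

  removed? : ∀ j → U.Decidable (Removed j)
  removed? j z = any? λ i → 2 ≤? toℕ i ×-dec (toℕ i ≤? j ×-dec v i ≟ z)

  q-removed : ∀ {i j} → 2 ≤ i → i ≤ j → i < ℓ → Removed j (q i)
  q-removed 2≤i i≤j i<ℓ = fromℕ< i<ℓ , subst (2 ≤_) (sym (toℕ-fromℕ< i<ℓ)) 2≤i ,
                           subst (_≤ _) (sym (toℕ-fromℕ< i<ℓ)) i≤j , sym (q-fromℕ< i<ℓ)

  removed-index : ∀ {j z} → Removed j z → ∃ λ i → 2 ≤ i × i ≤ j × i < ℓ × q i ≡ z
  removed-index (i , 2≤i , i≤j , vi≡z) = toℕ i , 2≤i , i≤j , toℕ<n i , trans (q-toℕ i) vi≡z

  q-not-removed : ∀ {a j} → a < ℓ → (∀ {i} → 2 ≤ i → i ≤ j → i ≢ a) → ¬ Removed j (q a)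
  q-not-removed a<ℓ other r =
    let (i , 2≤i , i≤j , i<ℓ , qi≡qa) = removed-index r in other 2≤i i≤j (q-injective i<ℓ a<ℓ qi≡qa)

  removed-suc : ∀ {j z} → Removed j z → Removed (suc j) z
  removed-suc (i , 2≤i , i≤j , vi≡z) = i , 2≤i , m≤n⇒m≤1+n i≤j , vi≡z

  removed-split : ∀ {j z} → Removed (suc j) z → Removed j z ⊎ z ≡ q (suc j)
  removed-split {j} (i , 2≤i , i≤1+j , vi≡z) with toℕ i ≤? j
  ... | yes i≤j = inj₁ (i , 2≤i , i≤j , vi≡z)
  ... | no  i≰j = inj₂ (trans (sym vi≡z) (trans (sym (q-toℕ i)) (cong q (≤-antisym i≤1+j (≰⇒> i≰j)))))

  Z-internal : ∀ {z} → InZ v z → ∃ λ k → suc (suc k) < ℓ × q (suc k) ≡ z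
  Z-internal r with removed-index r
  ... | suc k , _ , k+1≤L+2 , _ , qk+1≡z = k , m≤n⇒m≤1+n (s≤s (s≤s k+1≤L+2)) , qk+1≡z

  Z-no-loop : ∀ i {z} → InZ v z → ¬ Joins (lookupE E i) z z
  Z-no-loop i Zz with Z-internal Zz
  ... | k , k+2<ℓ , refl = Internal.no-loop k k+2<ℓ
      (q-≢ k+1<ℓ (<⇒≤ k+1<ℓ) (λ ())) (q-≢ k+1<ℓ k+2<ℓ (λ ())) i
    where
    k+1<ℓ : suc k < ℓ
    k+1<ℓ = <⇒≤ k+2<ℓ

  Z-no-parallel : ∀ i j {z t} → i ≢ j → InZ v z → Joins (lookupE E i) z t → Joins (lookupE E j) z t → ⊥
  Z-no-parallel i j i≢j Zz with Z-internal Zz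
  ... | k , k+2<ℓ , refl = Internal.no-parallel k k+2<ℓ i j i≢j

  x : Fin n
  x = q 1

  x<ℓ : 1 < ℓ
  x<ℓ = s≤s (s≤s z≤n)

  x-not-removed : ∀ {j} → ¬ Removed j x
  x-not-removed = q-not-removed x<ℓ λ { (s≤s ()) _ refl }

  module Dx = Internal 0 (s≤s (s≤s (s≤s z≤n)))

  module Chain (S : Subset n) (S-avoids-Z : ∀ {z} → InZ v z → z ∉ₛ S) where

    -- Gⱼ − S, where Gⱼ has v₂ … vⱼ removed and the edge v₁ v_(j+1) added (0-indexed).
    Alive : ℕ → Pred (Fin n) 0ℓ
    Alive j = Del (λ z → ¬ Removed j z) S

    Edges : ℕ → List (Edge n)
    Edges j = E ∷ʳ (x , q (suc j))

    Adjⱼ : ℕ → Rel (Fin n) 0ℓ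
    Adjⱼ j = Adj (Alive j) (Edges j)

    Good : ℕ → Set
    Good j = CliqueOrTree (Alive j) (Adjⱼ j)

    alive? : ∀ j → U.Decidable (Alive j)
    alive? j z = Dec.¬? (removed? j z) ×-dec Dec.¬? (z ∈ₛ? S)

    x-alive : x ∉ₛ S → ∀ j → Alive j x
    x-alive x∉S j = x-not-removed , x∉S

    module Step (j : ℕ) (1≤j : 1 ≤ j) (j≤L+1 : j ≤ suc L) where

      w y : Fin n
      w = q (suc j)
      y = q (suc (suc j))

      w<ℓ : suc j < ℓ
      w<ℓ = s≤s (s≤s (m≤n⇒m≤1+n (m≤n⇒m≤1+n j≤L+1)))
      y<ℓ : suc (suc j) < ℓ
      y<ℓ = s≤s (s≤s (s≤s (m≤n⇒m≤1+n j≤L+1)))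
      y+1<ℓ : suc (suc (suc j)) < ℓ
      y+1<ℓ = s≤s (s≤s (s≤s (s≤s j≤L+1)))

      module Dw = Internal j y<ℓ
      module Dy = Internal (suc j) y+1<ℓ

      x≢y : x ≢ y
      x≢y = q-≢ x<ℓ y<ℓ (λ ())

      w-removed : Removed (suc j) w
      w-removed = q-removed (s≤s 1≤j) ≤-refl w<ℓ

      w-alive : Alive j w
      w-alive = q-not-removed w<ℓ (λ { _ i≤j refl → <-irrefl refl i≤j }) ,
                S-avoids-Z (q-removed (s≤s 1≤j) (s≤s j≤L+1) w<ℓ)

      y-alive : y ∉ₛ S → ∀ {t} → t ≤ suc j → Alive t y
      y-alive y∉S t≤j+1 = q-not-removed y<ℓ (λ { _ i≤t refl → <-irrefl refl (≤-trans i≤t t≤j+1) }) , y∉S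

      Alive′⊆Alive : ∀ {z} → Alive (suc j) z → Alive j z
      Alive′⊆Alive = Product.map₁ (_∘ removed-suc)

      Alive′-≢w : ∀ {z} → Alive (suc j) z → z ≢ w
      Alive′-≢w (not-removed , _) refl = not-removed w-removed

      Alive⊆Alive′ : ∀ {z} → Alive j z → z ≢ w → Alive (suc j) z
      Alive⊆Alive′ (not-removed , z∉S) z≢w = Sum.[ not-removed , z≢w ] ∘ removed-split , z∉S

      A⇒A′ : ∀ {a b} → Adjⱼ j a b → a ≢ w → b ≢ w → Adjⱼ (suc j) a b
      A⇒A′ p a≢w b≢w with adj-∷ʳ⁻ E p
      ... | inj₁ p′ = adj-++⁺ˡ (adj-restrict (Alive⊆Alive′ (adj-presˡ p′) a≢w) (Alive⊆Alive′ (adj-presʳ p′) b≢w) p′)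
      ... | inj₂ (_ , inj₁ (_ , w≡b)) = ⊥-elim (b≢w (sym w≡b))
      ... | inj₂ (_ , inj₂ (_ , w≡a)) = ⊥-elim (a≢w (sym w≡a))

      A′⇒A-or-xy : ∀ {a b} → Adjⱼ (suc j) a b → Adjⱼ j a b ⊎ (a ≡ x × b ≡ y) ⊎ (a ≡ y × b ≡ x)
      A′⇒A-or-xy p with adj-∷ʳ⁻ E p
      ... | inj₁ p′                    = inj₁ (adj-++⁺ˡ (adj-mono Alive′⊆Alive p′))
      ... | inj₂ (_ , inj₁ (x≡a , y≡b)) = inj₂ (inj₁ (sym x≡a , sym y≡b))
      ... | inj₂ (_ , inj₂ (x≡b , y≡a)) = inj₂ (inj₂ (sym y≡a , sym x≡b))

      A′⇒A : ¬ (Alive (suc j) x × Alive (suc j) y) → Adjⱼ (suc j) ⇒ Adjⱼ j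
      A′⇒A xy-dead p with adj-∷ʳ⁻ E p
      ... | inj₁ p′       = adj-++⁺ˡ (adj-mono Alive′⊆Alive p′)
      ... | inj₂ (live , _) = ⊥-elim (xy-dead live)

      only-xy : ∀ {z} → Adjⱼ j w z → z ≡ x ⊎ z ≡ y
      only-xy p with adj-∷ʳ⁻ E p
      ... | inj₂ (_ , jn) = inj₁ (joins-functional jn (inj₂ (refl , refl)))
      ... | inj₁ p′ with Dw.neighbour p′
      ...   | inj₂ z≡y  = inj₂ z≡y
      ...   | inj₁ z≡qj with 2 ≤? j
      ...     | yes 2≤j = ⊥-elim (proj₁ (adj-presʳ p′) (subst (Removed j) (sym z≡qj) (q-removed 2≤j ≤-refl (<⇒≤ w<ℓ))))
      ...     | no  2≰j = inj₁ (trans z≡qj (cong q (≤-antisym (≤-pred (≰⇒> 2≰j)) 1≤j)))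

      A-wx : Alive j x → Adjⱼ j w x
      A-wx x-alive = adj-∷ʳ⁺ E (x-alive , w-alive) (inj₂ (refl , refl))

      A-wy : Alive j y → Adjⱼ j w y
      A-wy y-alive = adj-++⁺ˡ (adj-restrict w-alive y-alive (q-adj (suc j) y<ℓ))

      A′-xy : Alive (suc j) x → Alive (suc j) y → Adjⱼ (suc j) x y
      A′-xy x-alive y-alive = adj-∷ʳ⁺ E (x-alive , y-alive) (inj₁ (refl , refl))

      ¬A-xy : ¬ Adjⱼ j x y
      ¬A-xy p with adj-∷ʳ⁻ E p
      ... | inj₂ (_ , jn) = q-≢ w<ℓ y<ℓ (λ ()) (joins-functional (inj₁ (refl , refl)) jn)
      ... | inj₁ p′ with Dx.neighbour p′
      ...   | inj₁ y≡q0 = q-≢ y<ℓ (s≤s z≤n) (λ ()) y≡q0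
      ...   | inj₂ y≡q2 = q-≢ y<ℓ (s≤s (s≤s (s≤s z≤n))) (λ { refl → <-irrefl refl 1≤j }) y≡q2

      x-neighbours : ∀ {z} → Adjⱼ (suc j) x z → z ≡ q 0 ⊎ z ≡ y
      x-neighbours p with adj-∷ʳ⁻ E p
      ... | inj₂ (_ , jn) = inj₂ (sym (joins-functional (inj₁ (refl , refl)) jn))
      ... | inj₁ p′ with Dx.neighbour p′
      ...   | inj₁ z≡q0 = inj₁ z≡q0
      ...   | inj₂ z≡q2 = ⊥-elim (proj₁ (adj-presʳ p′)
                                  (subst (Removed (suc j)) (sym z≡q2) (q-removed ≤-refl (s≤s 1≤j) (s≤s (s≤s (s≤s z≤n))))))

      y-neighbours : ∀ {z} → Adjⱼ (suc j) y z → z ≡ q (suc (suc (suc j))) ⊎ z ≡ x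
      y-neighbours p with adj-∷ʳ⁻ E p
      ... | inj₂ (_ , jn) = inj₂ (sym (joins-functional (inj₂ (refl , refl)) jn))
      ... | inj₁ p′ with Dy.neighbour p′
      ...   | inj₁ z≡w     = ⊥-elim (Alive′-≢w (adj-presʳ p′) z≡w)
      ...   | inj₂ z≡qj+3 = inj₁ z≡qj+3

      no-common : ∀ {z} → Adjⱼ (suc j) x z → Adjⱼ (suc j) y z → ⊥
      no-common px py with x-neighbours px | y-neighbours py
      ... | inj₁ z≡q0 | inj₁ z≡qj+3 = q-≢ (s≤s z≤n) y+1<ℓ (λ ()) (trans (sym z≡q0) z≡qj+3)
      ... | inj₁ z≡q0 | inj₂ z≡x    = q-≢ (s≤s z≤n) x<ℓ (λ ()) (trans (sym z≡q0) z≡x)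
      ... | inj₂ z≡y  | inj₁ z≡qj+3 = q-≢ y<ℓ y+1<ℓ (λ ()) (trans (sym z≡y) z≡qj+3)
      ... | inj₂ z≡y  | inj₂ z≡x    = x≢y (trans (sym z≡x) z≡y)

      open VertexRemoval _≟_ w adj-sym adj-sym adj-presʳ Alive′⊆Alive Alive′-≢w Alive⊆Alive′ A⇒A′

      A′? : Decidable (Adjⱼ (suc j))
      A′? = adj? (alive? (suc j)) (Edges (suc j))

      alive⇒∉S : ∀ {t z} → Alive t z → z ∈ₛ S → ⊥
      alive⇒∉S (_ , z∉S) = z∉S

      good⇔ : Good j ⇔ Good (suc j)
      good⇔ with x ∈ₛ? S | y ∈ₛ? S
      ... | no x∉S | no y∉S = Suppressed.cliqueOrTree⇔ x y (x-alive x∉S (suc j)) x≢y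
            (A-wx (x-alive x∉S j)) (A-wy (y-alive y∉S (n≤1+n j))) only-xy A′⇒A-or-xy
            (A′-xy (x-alive x∉S (suc j)) (y-alive y∉S ≤-refl)) ¬A-xy no-common A′?
      ... | no x∉S | yes y∈S = Pendant.cliqueOrTree⇔ x (x-alive x∉S (suc j)) only-x
            (A′⇒A (λ (_ , y-alive) → alive⇒∉S y-alive y∈S)) (λ p₁ p₂ → trans (to-q0 p₁) (sym (to-q0 p₂))) A′?
        where
        only-x : ∀ {z} → Adjⱼ j w z → z ≡ x
        only-x p = Sum.[ id , (λ { refl → ⊥-elim (alive⇒∉S (adj-presʳ p) y∈S) }) ] (only-xy p)
        to-q0 : ∀ {z} → Adjⱼ (suc j) x z → z ≡ q 0
        to-q0 p = Sum.[ id , (λ { refl → ⊥-elim (alive⇒∉S (adj-presʳ p) y∈S) }) ] (x-neighbours p)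
      ... | yes x∈S | no y∉S = Pendant.cliqueOrTree⇔ y (y-alive y∉S ≤-refl) only-y
            (A′⇒A (λ (x-alive , _) → alive⇒∉S x-alive x∈S)) (λ p₁ p₂ → trans (to-qj+3 p₁) (sym (to-qj+3 p₂))) A′?
        where
        only-y : ∀ {z} → Adjⱼ j w z → z ≡ y
        only-y p = Sum.[ (λ { refl → ⊥-elim (alive⇒∉S (adj-presʳ p) x∈S) }) , id ] (only-xy p)
        to-qj+3 : ∀ {z} → Adjⱼ (suc j) y z → z ≡ q (suc (suc (suc j)))
        to-qj+3 p = Sum.[ id , (λ { refl → ⊥-elim (alive⇒∉S (adj-presʳ p) x∈S) }) ] (y-neighbours p)
      ... | yes x∈S | yes y∈S = Isolated.cliqueOrTree⇔
            (λ p → Sum.[ (λ { refl → alive⇒∉S (adj-presʳ p) x∈S }) , (λ { refl → alive⇒∉S (adj-presʳ p) y∈S }) ] (only-xy p))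
            (A′⇒A (λ (x-alive , _) → alive⇒∉S x-alive x∈S))

    good-chain : ∀ d → d ≤ suc L → Good 1 ⇔ Good (suc d)
    good-chain zero    _        = ⇔-id (Good 1)
    good-chain (suc d) d+1≤L+1 = Step.good⇔ (suc d) (s≤s z≤n) d+1≤L+1 ⇔-∘ good-chain d (<⇒≤ d+1≤L+1)

    -- G₁ is G with the edge v₁v₂ doubled, which does not change adjacency.
    good-start : CliqueOrTree (Del AllV S) (Adj (Del AllV S) E) ⇔ Good 1
    good-start = mk⇔ (cliqueOrTree-induced to-W₀ A₁⇒A₀ (λ _ _ → A₀⇒A₁) adj-presʳ)
                     (cliqueOrTree-induced to-W₁ A₀⇒A₁ (λ _ _ → A₁⇒A₀) adj-presʳ)
      where
      to-W₀ : ∀ {z} → Alive 1 z → Del AllV S z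
      to-W₀ (_ , z∉S) = tt , z∉S
      to-W₁ : ∀ {z} → Del AllV S z → Alive 1 z
      to-W₁ (_ , z∉S) = (λ (_ , 2≤i , i≤1 , _) → <-irrefl refl (≤-trans 2≤i i≤1)) , z∉S
      A₀⇒A₁ : Adj (Del AllV S) E ⇒ Adjⱼ 1
      A₀⇒A₁ p = adj-++⁺ˡ (adj-mono to-W₁ p)
      A₁⇒A₀ : Adjⱼ 1 ⇒ Adj (Del AllV S) E
      A₁⇒A₀ p with adj-∷ʳ⁻ E p
      ... | inj₁ p′ = adj-mono to-W₀ p′
      ... | inj₂ ((x-alive , q2-alive) , inj₁ (refl , refl)) =
            adj-restrict (to-W₀ x-alive) (to-W₀ q2-alive) (q-adj 1 (s≤s (s≤s (s≤s z≤n))))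
      ... | inj₂ ((x-alive , q2-alive) , inj₂ (refl , refl)) =
            adj-sym (adj-restrict (to-W₀ x-alive) (to-W₀ q2-alive) (q-adj 1 (s≤s (s≤s (s≤s z≤n)))))

    cliqueOrTree⇔ : CliqueOrTree (Del AllV S) (Adj (Del AllV S) E) ⇔
                    CliqueOrTree (Del (λ z → ¬ InZ v z) S) (Adj (Del (λ z → ¬ InZ v z) S) (E ∷ʳ (x , q (3 + L))))
    cliqueOrTree⇔ = good-chain (suc L) ≤-refl ⇔-∘ good-start

  NotZ : Pred (Fin n) 0ℓ
  NotZ z = ¬ InZ v z

  e′ : Edge n
  e′ = x , q (3 + L)

  e′-edge : ∀ a b → toℕ a ≡ 1 → toℕ b ≡ 3 + L → (v a , v b) ≡ e′
  e′-edge a b a≡1 b≡L+3 = cong₂ _,_ (trans (sym (q-toℕ a)) (cong q a≡1)) (trans (sym (q-toℕ b)) (cong q b≡L+3))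

  simple-add : ∀ {W W′ : Pred (Fin n) 0ℓ} → Simple W E → (∀ {z} → W′ z → W z) → Simple W′ (E ∷ʳ e′)
  simple-add {W} {W′} simple W′⊆W = simple-∷ʳ⁺ {W = W} {W′} {E} {e′} simple W′⊆W (q-≢ x<ℓ L+3<ℓ (λ ())) e′-new
    where
    L+3<ℓ : 3 + L < ℓ
    L+3<ℓ = s≤s (s≤s (s≤s (s≤s (n≤1+n L))))
    e′-new : ∀ i → ¬ Joins (lookupE E i) x (q (3 + L))
    e′-new i jn = Sum.[ q-≢ L+3<ℓ (s≤s z≤n) (λ ()) ∘ joins-functional jn ,
                        q-≢ L+3<ℓ (s≤s (s≤s (s≤s z≤n))) (λ ()) ∘ joins-functional jn ]
                      (Dx.incident-edge i (joins-incident jn))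

  simple-remove : ∀ {S} → Simple (Del NotZ S) (E ∷ʳ e′) → Simple (Del AllV S) E
  simple-remove {S} = simple-∷ʳ⁻ {W = Del AllV S} {Del NotZ S} {InZ v} {E} {e′} (removed? (suc (suc L))) (λ (_ , z∉S) ¬Zz → ¬Zz , z∉S) Z-no-loop Z-no-parallel

  yes⇒yes′ : ∀ {k} → YesCTVD AllV E k → YesCTVD NotZ (E ∷ʳ e′) k
  yes⇒yes′ (S , _ , |S|≤k , deletion) with Equivalence.to goodDeletion⇔ deletion
                                          | any? (λ z → z ∈ₛ? S ×-dec removed? (suc (suc L)) z)
  ... | simple , good | no S∩Z=∅ =
        S , (λ z z∈S Zz → S∩Z=∅ (z , z∈S , Zz)) , |S|≤k ,
        Equivalence.from goodDeletion⇔
          (simple-add {Del AllV S} {Del NotZ S} simple (λ (_ , z∉S) → tt , z∉S) ,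
           Equivalence.to (Chain.cliqueOrTree⇔ S λ Zz z∈S → S∩Z=∅ (_ , z∈S , Zz)) good)
  ... | simple , good | yes (z , z∈S , Zz) with exchange S (removed? (suc (suc L))) x-not-removed z∈S Zz
  ...   | S′ , |S′|≤|S| , x∈S′ , S′-avoids-Z , keeps =
        S′ , (λ _ → S′-avoids-Z) , ≤-trans |S′|≤|S| |S|≤k ,
        Equivalence.from goodDeletion⇔
          (simple-add {Del AllV S} simple W′⊆W , cliqueOrTree-induced W′⊆W A′⇒A (λ Wa Wb → adj-++⁺ˡ ∘ adj-restrict Wa Wb) adj-presʳ good)
    where
    W′⊆W : ∀ {t} → Del NotZ S′ t → Del AllV S t
    W′⊆W (¬Zt , t∉S′) = tt , λ t∈S → t∉S′ (keeps t∈S ¬Zt)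
    A′⇒A : Adj (Del NotZ S′) (E ∷ʳ e′) ⇒ Adj (Del AllV S) E
    A′⇒A p with adj-∷ʳ⁻ E p
    ... | inj₁ p′                  = adj-mono W′⊆W p′
    ... | inj₂ (((_ , x∉S′) , _) , _) = ⊥-elim (x∉S′ x∈S′)

  yes′⇒yes : ∀ {k} → YesCTVD NotZ (E ∷ʳ e′) k → YesCTVD AllV E k
  yes′⇒yes (S , S⊆NotZ , |S|≤k , deletion) with Equivalence.to goodDeletion⇔ deletion
  ... | simple , good =
        S , (λ _ _ → tt) , |S|≤k ,
        Equivalence.from goodDeletion⇔
          (simple-remove {S} simple , Equivalence.from (Chain.cliqueOrTree⇔ S λ Zz z∈S → S⊆NotZ _ z∈S Zz) good)

lemma16 : ∀ {n} (E : List (Edge n)) (k ℓ : ℕ) → 5 ≤ ℓ → (v : Fin ℓ → Fin n)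
    → Injective _≡_ _≡_ v
    → (∀ (i j : Fin ℓ) → suc (toℕ i) ≡ toℕ j → Adj AllV E (v i) (v j))
    → (∀ (i : Fin ℓ) → 1 ≤ toℕ i → suc (toℕ i) < ℓ → deg E (v i) ≡ 2)
    → (∀ (i : Fin ℓ) → (toℕ i ≡ 0 ⊎ suc (toℕ i) ≡ ℓ) → 2 < deg E (v i))
    → (a b : Fin ℓ) → toℕ a ≡ 1 → toℕ b ≡ ℓ ∸ 2
    → (YesCTVD AllV E k → YesCTVD (λ x → ¬ InZ v x) (E ++ ((v a , v b) ∷ [])) k)
    × (YesCTVD (λ x → ¬ InZ v x) (E ++ ((v a , v b) ∷ [])) k → YesCTVD AllV E k)
lemma16 E k _ (s≤s (s≤s (s≤s (s≤s (s≤s _))))) v v-inj v-adj v-deg _ a b a≡1 b≡ℓ-2 =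
  subst (λ e → (YesCTVD AllV E k → YesCTVD NotZ (E ∷ʳ e) k) × (YesCTVD NotZ (E ∷ʳ e) k → YesCTVD AllV E k))
        (sym (e′-edge a b a≡1 b≡ℓ-2)) (yes⇒yes′ , yes′⇒yes)
  where open SuppressedPath E v v-inj v-adj v-deg
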